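{- Let $(P,N)$ be a PGAS program and $\tau\in\mathrm C(P,N)$. Then $\tau$ is violating if and only if there exist $k\ge1$ and events $a_1,b_1,c_1,d_1,\dots,a_k,b_k,c_k,d_k$ of $\tau$ forming a happens-before cycle $$a_1\equiv^*b_1\ \mathit{po}^*\ c_1\equiv^*d_1\ \mathit{cyc}\ a_2\equiv^* b_2\ \mathit{po}^*\ c_2\equiv^*d_2\ \mathit{cyc}\ \cdots\ \mathit{cyc}\ a_k\equiv^*b_k\ \mathit{po}^*\ c_k\equiv^*d_k\ \mathit{cyc}\ a_1$$ that is not included in $\equiv$, where $\mathit{cyc}=\mathit{cf}\cup\equiv$, and such that for all $x_i\in\{a_i,b_i,c_i,d_i\}$ and $y_j\in\{a_j,b_j,c_j,d_j\}$ we have $\mathrm{rank}(x_i)=\mathrm{rank}(y_j)$ iff $i=j$.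
   Context: PGAS programs. Fix finite domains of values $D$, addresses $A$, queue identifiers $Q$ (each containing $0$) and a finite set of registers $\mathit{Reg}$. Commands are: $r\leftarrow \mathtt{mem}[e]$, $\mathtt{mem}[e]\leftarrow e'$, $r\leftarrow e$, $\mathtt{assume}(e)$, $\mathtt{read}(e_{la},e_{r},e_{ra},e_{q})$, $\mathtt{write}(e_{la},e_{r},e_{ra},e_{q})$, $\mathtt{barrier}$ (expressions over constants, registers and operators on $D$; $e_r$ evaluates in $\{1,\dots,N\}$). A program code is a finite automaton $P=(C,\mathit{Cmd},I,c_0,C)$; a PGAS program $(P,N)$ runs one copy of $P$ per rank in $\mathit{Ranks}=\{1,\dots,N\}$. Semantics. States $(sc,M,\mathcal P,\mathcal V)$: $sc:\mathit{Ranks}\to C$, $M:\mathit{Ranks}\times(\mathit{Reg}\cup A)\to D$, FIFO queues $\mathcal P(r,q)$ of tuples $(r_s,a_s,r_d,a_d)$ and $\mathcal V(r,q)$ of tuples $(r_d,a_d,v)$. Initially control $c_0$, memory $0$, queues empty. Events $(k,r,x)$ with kind $k\in\{\mathit{load},\mathit{store},\mathit{assign},\mathit{assume},\mathit{read},\mathit{write},\mathit{pop}_a,\mathit{pop}_b,\mathit{barrier}\}$, rank $\mathrm{rank}=r$, address $x\in(\mathit{Ranks}\times A)\cup\{\bot\}$. For a transition $sc(r)\xrightarrow{cmd}c_2$ of process $r$ (expressions evaluated in $r$'s registers): load emits $(\mathit{load},r,(r,a))$ and copies $M(r,a)$ into a register; store emits $(\mathit{store},r,(r,a))$ and writes $M(r,a)$;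 assign emits $(\mathit{assign},r,\bot)$; assume$(e)$ needs $\mathit{val}(e)\ne0$ and emits $(\mathit{assume},r,\bot)$; write emits $(\mathit{write},r,\bot)$ and appends $(r,\mathit{val}(e_{la}),\mathit{val}(e_r),\mathit{val}(e_{ra}))$ to $\mathcal P(r,\mathit{val}(e_q))$; read emits $(\mathit{read},r,\bot)$ and appends $(\mathit{val}(e_r),\mathit{val}(e_{ra}),r,\mathit{val}(e_{la}))$ to $\mathcal P(r,\mathit{val}(e_q))$. At any time the head $(r_s,a_s,r_d,a_d)$ of $\mathcal P(r,q)$ can be removed, emitting $(\mathit{pop}_a,r,(r_s,a_s))$ and appending $(r_d,a_d,M(r_s,a_s))$ to $\mathcal V(r,q)$; the head $(r_d,a_d,v)$ of $\mathcal V(r,q)$ can be removed, emitting $(\mathit{pop}_b,r,(r_d,a_d))$ and setting $M(r_d,a_d):=v$. If all processes have a barrier transition enabled, all take it, emitting $(\mathit{barrier},1,\bot)\cdots(\mathit{barrier},N,\bot)$. $\mathrm C(P,N)$: event sequences of runs from the initial state to a state with all queues empty. Writes of an address: kinds $\mathit{store},\mathit{pop}_b$; reads: $\mathit{load},\mathit{pop}_a$. Happens-before of $\tau$: $\mathit{po}\cup\mathit{cf}\cup\equiv$ on event occurrences, where $\mathit{po}$ relates, per rank, consecutive events among that rank's events of kind other than $\mathit{pop}_a,\mathit{pop}_b$; $e_1\,\mathit{cf}\,e_2$ iff $e_1$ precedes $e_2$, both access the same address, at least one is a write, and no write to that address lies strictly between them; $\equiv$ is the symmetric relation linking each $\mathit{read}$/$\mathit{write}$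 event with the $\mathit{pop}_a$ event handling its queue entry and the $\mathit{pop}_b$ event handling the entry produced by that $\mathit{pop}_a$ (and the two pops with each other), and linking all barrier events of the same barrier step. $R^*$ denotes reflexive-transitive closure. $\tau$ is violating if its happens-before relation contains a cycle not included in $\equiv$. -}

module Defs where

open import Data.Nat as ℕ using (ℕ; zero; suc)
open import Data.Nat.DivMod using (_%_; m%n<n)
open import Data.Fin as Fin using (Fin; toℕ; fromℕ<) renaming (_≟_ to _≟F_)
open import Data.Fin.Properties using () renaming (_<?_ to _<F?_)
open import Data.List using (List; []; _∷_; _++_; [_]; length; lookup; map; allFin)
open import Data.List.Membership.Propositional using (_∈_)
open import Data.Maybe using (Maybe; just; nothing)
open import Data.Product using (Σ; _×_; _,_; ∃)
open import Data.Sum using (_⊎_; inj₁; inj₂)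
import Data.Sum.Properties as SumP
open import Data.Bool using (if_then_else_)
open import Relation.Nullary using (¬_; Dec; yes; no; does)
open import Relation.Binary.PropositionalEquality using (_≡_; _≢_)
open import Relation.Binary.Construct.Closure.ReflexiveTransitive using (Star; ε; _◅_)
open import Function.Bundles using (_⇔_)

record Params : Set where
  field
    nD nA nQ nR : ℕ

module _ (Π : Params) where
  open Params Π

  D : Set
  D = Fin (suc nD)

  Addr : Set
  Addr = Fin (suc nA)

  QId : Set
  QId = Fin (suc nQ)

  Reg : Set
  Reg = Fin nR

  data Expr : Set where
    const : D → Expr
    reg   : Reg → Expr
    op    : {k : ℕ} → ((Fin k → D) → D) → (Fin k → Expr) → Expr

  eval : (Reg → D) → Expr → D
  eval ρ (const v) = v
  eval ρ (reg x)   = ρ x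
  eval ρ (op f es) = f (λ i → eval ρ (es i))

  toAddr : D → Maybe Addr
  toAddr v with suc (toℕ v) ℕ.≤? suc nA
  ... | yes p = just (fromℕ< p)
  ... | no _  = nothing

  toQ : D → Maybe QId
  toQ v with suc (toℕ v) ℕ.≤? suc nQ
  ... | yes p = just (fromℕ< p)
  ... | no _  = nothing

  -- A value v ∈ {1..N} denotes rank v; ranks are represented by Fin N
  -- (rank v is the element with toℕ = v - 1).
  toRank : (N : ℕ) → D → Maybe (Fin N)
  toRank N v with toℕ v
  ... | zero  = nothing
  ... | suc w with suc w ℕ.≤? N
  ...   | yes p = just (fromℕ< p)
  ...   | no _  = nothing

  data Cmd : Set where
    load    : Reg → Expr → Cmd
    store   : Expr → Expr → Cmd                     -- mem[e] ← e'
    assign  : Reg → Expr → Cmd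
    assume  : Expr → Cmd
    read    : Expr → Expr → Expr → Expr → Cmd       -- read(e_la, e_r, e_ra, e_q)
    write   : Expr → Expr → Expr → Expr → Cmd       -- write(e_la, e_r, e_ra, e_q)
    barrier : Cmd

  -- Program code: finite automaton with control states Fin (suc nC),
  -- initial state c0, finite transition relation (all states final).
  record Program : Set where
    field
      nC    : ℕ
      c0    : Fin (suc nC)
      trans : List (Fin (suc nC) × Cmd × Fin (suc nC))

  data Kind : Set where
    k-load k-store k-assign k-assume k-read k-write k-popa k-popb k-barrier : Kind

  -- Besides kind, rank and address, an event occurrence
  -- carries the bookkeeping needed to define ≡ : the tag  inj₁ p  marks the
  -- read/write event at position p of the trace and the pops handling its
  -- queue entries; the tag  inj₂ p  marks the barrier events of the barrier
  -- step whose first event is at position p.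
  record Event (N : ℕ) : Set where
    constructor ⟨_,_,_,_⟩
    field
      kind : Kind
      rank : Fin N
      addr : Maybe (Fin N × Addr)
      tag  : Maybe (ℕ ⊎ ℕ)
  open Event public

  module Sem (P : Program) (N : ℕ) where
    open Program P

    Ctrl : Set
    Ctrl = Fin (suc nC)

    Rank : Set
    Rank = Fin N

    Loc : Set
    Loc = Reg ⊎ Addr

    _≟L_ : (x y : Loc) → Dec (x ≡ y)
    _≟L_ = SumP.≡-dec _≟F_ _≟F_

    -- entries (r_s, a_s, r_d, a_d) of P-queues, with the position of the
    -- originating read/write event
    PEntry : Set
    PEntry = Rank × Addr × Rank × Addr × ℕ

    -- entries (r_d, a_d, v) of V-queues, with the origin position
    VEntry : Set
    VEntry = Rank × Addr × D × ℕ

    record State : Set where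
      field
        sc : Rank → Ctrl
        M  : Rank → Loc → D
        PQ : Rank → QId → List PEntry
        VQ : Rank → QId → List VEntry
    open State public

    initial : State
    initial = record
      { sc = λ _ → c0 ; M = λ _ _ → Fin.zero ; PQ = λ _ _ → [] ; VQ = λ _ _ → [] }

    upd1 : {B : Set} → (Rank → B) → Rank → B → Rank → B
    upd1 f r b r' = if does (r' ≟F r) then b else f r'

    updM : (Rank → Loc → D) → Rank → Loc → D → Rank → Loc → D
    updM f r l v r' l' = if does (r' ≟F r) then (if does (l' ≟L l) then v else f r' l') else f r' l'

    updQ : {B : Set} → (Rank → QId → B) → Rank → QId → B → Rank → QId → B
    updQ f r q b r' q' = if does (r' ≟F r) then (if does (q' ≟F q) then b else f r' q') else f r' q'

    regs : State → Rank → Reg → D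
    regs s r x = M s r (inj₁ x)

    -- Step o s es s' : from s, emit the events es (the first of which is at
    -- position o of the trace) and reach s'.
    data Step (o : ℕ) : State → List (Event N) → State → Set where
      st-load : ∀ {s r x e c₂ a} →
        (sc s r , load x e , c₂) ∈ trans →
        toAddr (eval (regs s r) e) ≡ just a →
        Step o s [ ⟨ k-load , r , just (r , a) , nothing ⟩ ]
          (record s { sc = upd1 (sc s) r c₂
                    ; M  = updM (M s) r (inj₁ x) (M s r (inj₂ a)) })
      st-store : ∀ {s r e e′ c₂ a} →
        (sc s r , store e e′ , c₂) ∈ trans →
        toAddr (eval (regs s r) e) ≡ just a →
        Step o s [ ⟨ k-store , r , just (r , a) , nothing ⟩ ]
          (record s { sc = upd1 (sc s) r c₂
                    ; M  = updM (M s) r (inj₂ a) (eval (regs s r) e′) })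
      st-assign : ∀ {s r x e c₂} →
        (sc s r , assign x e , c₂) ∈ trans →
        Step o s [ ⟨ k-assign , r , nothing , nothing ⟩ ]
          (record s { sc = upd1 (sc s) r c₂
                    ; M  = updM (M s) r (inj₁ x) (eval (regs s r) e) })
      st-assume : ∀ {s r e c₂} →
        (sc s r , assume e , c₂) ∈ trans →
        eval (regs s r) e ≢ Fin.zero →
        Step o s [ ⟨ k-assume , r , nothing , nothing ⟩ ]
          (record s { sc = upd1 (sc s) r c₂ })
      st-write : ∀ {s r ela er era eq c₂ la rd ra q} →
        (sc s r , write ela er era eq , c₂) ∈ trans →
        toAddr (eval (regs s r) ela) ≡ just la →
        toRank N (eval (regs s r) er) ≡ just rd →
        toAddr (eval (regs s r) era) ≡ just ra →
        toQ (eval (regs s r) eq) ≡ just q →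
        Step o s [ ⟨ k-write , r , nothing , just (inj₁ o) ⟩ ]
          (record s { sc = upd1 (sc s) r c₂
                    ; PQ = updQ (PQ s) r q (PQ s r q ++ [ (r , la , rd , ra , o) ]) })
      st-read : ∀ {s r ela er era eq c₂ la rs ra q} →
        (sc s r , read ela er era eq , c₂) ∈ trans →
        toAddr (eval (regs s r) ela) ≡ just la →
        toRank N (eval (regs s r) er) ≡ just rs →
        toAddr (eval (regs s r) era) ≡ just ra →
        toQ (eval (regs s r) eq) ≡ just q →
        Step o s [ ⟨ k-read , r , nothing , just (inj₁ o) ⟩ ]
          (record s { sc = upd1 (sc s) r c₂
                    ; PQ = updQ (PQ s) r q (PQ s r q ++ [ (rs , ra , r , la , o) ]) })
      st-popa : ∀ {s r q rs as rd ad t rest} →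
        PQ s r q ≡ (rs , as , rd , ad , t) ∷ rest →
        Step o s [ ⟨ k-popa , r , just (rs , as) , just (inj₁ t) ⟩ ]
          (record s { PQ = updQ (PQ s) r q rest
                    ; VQ = updQ (VQ s) r q (VQ s r q ++ [ (rd , ad , M s rs (inj₂ as) , t) ]) })
      st-popb : ∀ {s r q rd ad v t rest} →
        VQ s r q ≡ (rd , ad , v , t) ∷ rest →
        Step o s [ ⟨ k-popb , r , just (rd , ad) , just (inj₁ t) ⟩ ]
          (record s { VQ = updQ (VQ s) r q rest
                    ; M  = updM (M s) rd (inj₂ ad) v })
      st-barrier : ∀ {s} (cs : Rank → Ctrl) →
        (∀ r → (sc s r , barrier , cs r) ∈ trans) →
        Step o s (map (λ r → ⟨ k-barrier , r , nothing , just (inj₂ o) ⟩) (allFin N))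
          (record s { sc = cs })

    data Reach : List (Event N) → State → Set where
      r-init : Reach [] initial
      r-step : ∀ {τ s es s′} → Reach τ s → Step (length τ) s es s′ → Reach (τ ++ es) s′

    QueuesEmpty : State → Set
    QueuesEmpty s = ∀ r q → PQ s r q ≡ [] × VQ s r q ≡ []

    InC : List (Event N) → Set
    InC τ = Σ State λ s → Reach τ s × QueuesEmpty s

  module HB {N : ℕ} (τ : List (Event N)) where

    Idx : Set
    Idx = Fin (length τ)

    ev : Idx → Event N
    ev = lookup τ

    NonPop : Event N → Set
    NonPop e = kind e ≢ k-popa × kind e ≢ k-popb

    IsWrite : Event N → Set
    IsWrite e = kind e ≡ k-store ⊎ kind e ≡ k-popb

    Po : Idx → Idx → Set
    Po i j = rank (ev i) ≡ rank (ev j) × NonPop (ev i) × NonPop (ev j) × i Fin.< j ×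
             (∀ k → i Fin.< k → k Fin.< j → rank (ev k) ≡ rank (ev i) → ¬ NonPop (ev k))

    Cf : Idx → Idx → Set
    Cf i j = i Fin.< j ×
             Σ (Fin N × Addr) (λ x →
               addr (ev i) ≡ just x × addr (ev j) ≡ just x ×
               (IsWrite (ev i) ⊎ IsWrite (ev j)) ×
               (∀ k → i Fin.< k → k Fin.< j → addr (ev k) ≡ just x → ¬ IsWrite (ev k)))

    Eqv : Idx → Idx → Set
    Eqv i j = i ≢ j × Σ (ℕ ⊎ ℕ) (λ t → tag (ev i) ≡ just t × tag (ev j) ≡ just t)

    HBrel : Idx → Idx → Set
    HBrel i j = Po i j ⊎ Cf i j ⊎ Eqv i j

    Cyc : Idx → Idx → Set
    Cyc i j = Cf i j ⊎ Eqv i j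

    Violating : Set
    Violating = Σ Idx λ i → Σ Idx λ j → HBrel i j × ¬ Eqv i j × Star HBrel j i

  data AnyEdge {I : Set} {R : I → I → Set} (S : I → I → Set) :
               {x y : I} → Star R x y → Set where
    here  : ∀ {x y z} {r : R x y} {rs : Star R y z} → S x y → AnyEdge S (r ◅ rs)
    there : ∀ {x y z} {r : R x y} {rs : Star R y z} → AnyEdge S rs → AnyEdge S (r ◅ rs)

  next : {m : ℕ} → Fin (suc m) → Fin (suc m)
  next {m} i = fromℕ< (m%n<n (suc (toℕ i)) (suc m))

  quad : {X I : Set} → (a b c d : I → X) → I → Fin 4 → X
  quad a b c d i Fin.zero = a i
  quad a b c d i (Fin.suc Fin.zero) = b i
  quad a b c d i (Fin.suc (Fin.suc Fin.zero)) = c i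
  quad a b c d i (Fin.suc (Fin.suc (Fin.suc Fin.zero))) = d i

  module _ {N : ℕ} (τ : List (Event N)) where
    open HB τ

    -- The cycle  a₁ ≡* b₁ po* c₁ ≡* d₁ cyc a₂ … d_k cyc a₁  (k = suc m ≥ 1),
    -- not included in ≡, with the rank-separation condition.
    record CycleWitness : Set where
      field
        m  : ℕ
        a b c d : Fin (suc m) → Idx
        ab : ∀ i → Star Eqv (a i) (b i)
        bc : ∀ i → Star Po (b i) (c i)
        cd : ∀ i → Star Eqv (c i) (d i)
        da : ∀ i → Cyc (d i) (a (next i))
        notInEqv : Σ (Fin (suc m)) λ i →
          AnyEdge (λ x y → ¬ Eqv x y) (ab i) ⊎ AnyEdge (λ x y → ¬ Eqv x y) (bc i) ⊎
          AnyEdge (λ x y → ¬ Eqv x y) (cd i) ⊎ ¬ Eqv (d i) (a (next i))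
        rankSep : ∀ i j (s t : Fin 4) →
          (rank (ev (quad a b c d i s)) ≡ rank (ev (quad a b c d j t))) ⇔ (i ≡ j)

module Submission where

-- Every pop is ≡-linked to the read/write that issued its queue entry, which has the same rank
-- and is not a pop: its origin (other events are their own origin). Writing pos e for the trace
-- position of the origin of e, po-chains on a rank are exactly the runs along which pos increases.
-- A violating cycle thus becomes a cyclic sequence of hops, each advancing in pos on one rank and
-- then taking one cf/≡ edge, where some hop advances strictly or takes an edge outside ≡. If two
-- hops leave the same rank, one of the two arcs between them closes up into a shorter such cycle;
-- so some such cycle leaves every rank at most once, and unfolding each hop as
-- a ≡* origin(a) po* origin(d) ≡* d cyc gives the witness. Conversely, the witness concatenates
-- into a happens-before cycle through its edge outside ≡.

open import Defs
open import Level using (0ℓ)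
open import Data.Nat as ℕ using (ℕ; zero; suc; _+_; _∸_; _≤_; _<_; s≤s; s≤s⁻¹; _≤?_; _<?_)
open import Data.Nat.DivMod using (n%n≡0; m<n⇒m%n≡m)
open import Data.Nat.Induction using (<-wellFounded)
open import Data.Nat.Properties
  using (≤-refl; ≤-trans; <-trans; n<1+n; <⇒≤; ≤-<-trans; <-≤-trans; <-irrefl; ≮⇒≥; ≰⇒>;
         m≤m+n; m≤n+m; +-comm; +-suc; +-identityʳ; m+[n∸m]≡n; m≤n⇒m<n∨m≡n)
open import Data.Nat.Solver using (module +-*-Solver)
open import Data.Fin as Fin using (Fin; toℕ; fromℕ; fromℕ<; inject₁) renaming (_≟_ to _≟F_)
open import Data.Fin.Induction using (<-weakInduction; >-weakInduction)
open import Data.Fin.Properties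
  using (toℕ-injective; toℕ-fromℕ; toℕ-fromℕ<; toℕ-inject₁; toℕ<n; any?)
open import Data.List using (List; []; _∷_; _++_; [_]; length; lookup; tabulate; map; allFin)
open import Data.List.Properties using (map-tabulate)
open import Data.List.Relation.Unary.All.Properties using (++⁺)
import Data.List.Relation.Unary.All as All
open import Data.List.Relation.Unary.All using (All; []; _∷_)
open import Data.Maybe using (Maybe; just; nothing)
import Data.Product as Product
open import Data.Product using (Σ; ∃; ∃₂; _×_; _,_; proj₁; proj₂; uncurry)
import Data.Sum as Sum
open import Data.Sum using (_⊎_; inj₁; inj₂)
open import Function using (_∘_; id; Injective; _⇔_; mk⇔)
open import Induction.WellFounded using (Acc; acc)
open import Relation.Nullary using (¬_; Dec; yes; no; contradiction)
open import Relation.Nullary.Decidable using (_×-dec_)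
open import Relation.Unary using (Pred; Decidable)
open import Relation.Binary.Core using (Rel)
open import Relation.Binary.Definitions using (DecidableEquality)
open import Relation.Binary.PropositionalEquality
  using (_≡_; _≢_; refl; sym; trans; cong; subst; module ≡-Reasoning)
import Relation.Binary.Construct.Closure.ReflexiveTransitive as Star
open import Relation.Binary.Construct.Closure.ReflexiveTransitive using (Star; ε; _◅_; _◅◅_)

module _ {I : Set} {R : Rel I 0ℓ} where

  private variable
    x y z : I

  size : Star R x y → ℕ
  size ε       = 0
  size (_ ◅ p) = suc (size p)

  size-◅◅ : (p : Star R x y) (q : Star R y z) → size (p ◅◅ q) ≡ size p + size q
  size-◅◅ ε       q = refl
  size-◅◅ (r ◅ p) q = cong suc (size-◅◅ p q)

  data AnyStep (P : ∀ {x y} → R x y → Set) : Star R x y → Set where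
    here  : ∀ {x y z} {r : R x y} {p : Star R y z} → P r → AnyStep P (r ◅ p)
    there : ∀ {x y z} {r : R x y} {p : Star R y z} → AnyStep P p → AnyStep P (r ◅ p)

  module _ {P : ∀ {x y} → R x y → Set} where

    AnyStep-++⁺ˡ : {p : Star R x y} (q : Star R y z) → AnyStep P p → AnyStep P (p ◅◅ q)
    AnyStep-++⁺ˡ q (here s)  = here s
    AnyStep-++⁺ˡ q (there s) = there (AnyStep-++⁺ˡ q s)

    AnyStep-++⁺ʳ : (p : Star R x y) {q : Star R y z} → AnyStep P q → AnyStep P (p ◅◅ q)
    AnyStep-++⁺ʳ ε       s = s
    AnyStep-++⁺ʳ (r ◅ p) s = there (AnyStep-++⁺ʳ p s)

    AnyStep-++⁻ : (p : Star R x y) {q : Star R y z} → AnyStep P (p ◅◅ q) → AnyStep P p ⊎ AnyStep P q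
    AnyStep-++⁻ ε       s         = inj₂ s
    AnyStep-++⁻ (r ◅ p) (here s)  = inj₁ (here s)
    AnyStep-++⁻ (r ◅ p) (there s) with AnyStep-++⁻ p s
    ... | inj₁ sp = inj₁ (there sp)
    ... | inj₂ sq = inj₂ sq

  source : (p : Star R x y) → Fin (size p) → I
  source {x} (r ◅ p) Fin.zero    = x
  source     (r ◅ p) (Fin.suc i) = source p i

  target : (p : Star R x y) → Fin (size p) → I
  target (_◅_ {j = y} r p) Fin.zero    = y
  target (r ◅ p)           (Fin.suc i) = target p i

  step : (p : Star R x y) (i : Fin (size p)) → R (source p i) (target p i)
  step (r ◅ p) Fin.zero    = r
  step (r ◅ p) (Fin.suc i) = step p i

  AnyStep-step : {P : ∀ {x y} → R x y → Set} {p : Star R x y} → AnyStep P p →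
                 ∃ λ i → P (step p i)
  AnyStep-step (here s)  = Fin.zero , s
  AnyStep-step (there s) with AnyStep-step s
  ... | i , si = Fin.suc i , si

  record Decomposition (p : Star R x y) (i : Fin (size p)) : Set where
    constructor decomposition
    field
      before : Star R x (source p i)
      after  : Star R (target p i) y
      splits : p ≡ before ◅◅ (step p i ◅ after)

  decompose : (p : Star R x y) (i : Fin (size p)) → Decomposition p i
  decompose (r ◅ p) Fin.zero    = decomposition ε p refl
  decompose (r ◅ p) (Fin.suc i) with decompose p i
  ... | decomposition before after splits = decomposition (r ◅ before) after (cong (r ◅_) splits)

  module _ {B : Set} (f : I → B) where

    data Repetition (p : Star R x y) : Set where
      repetition : ∀ {u u′ v v′} (pre : Star R x u) (r₁ : R u u′) (mid : Star R u′ v)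
                   (r₂ : R v v′) (post : Star R v′ y) →
                   f u ≡ f v → p ≡ pre ◅◅ (r₁ ◅ (mid ◅◅ (r₂ ◅ post))) → Repetition p

    injective-or-repetition : DecidableEquality B → (p : Star R x y) →
                              Injective _≡_ _≡_ (f ∘ source p) ⊎ Repetition p
    injective-or-repetition _≟_ ε = inj₁ λ { {()} }
    injective-or-repetition {x} _≟_ (r ◅ p) with injective-or-repetition _≟_ p
    ... | inj₂ (repetition pre r₁ mid r₂ post e refl) =
      inj₂ (repetition (r ◅ pre) r₁ mid r₂ post e refl)
    ... | inj₁ injective-p with any? (λ j → f x ≟ f (source p j))
    ...   | yes (j , e) with decompose p j
    ...     | decomposition before after splits =
      inj₂ (repetition ε r before (step p j) after e (cong (r ◅_) splits))
    injective-or-repetition {x} _≟_ (r ◅ p) | inj₁ injective-p | no fresh = inj₁ injective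
      where
      injective : Injective _≡_ _≡_ (f ∘ source (r ◅ p))
      injective {Fin.zero}  {Fin.zero}  _ = refl
      injective {Fin.zero}  {Fin.suc j} e = contradiction (j , e) fresh
      injective {Fin.suc i} {Fin.zero}  e = contradiction (i , sym e) fresh
      injective {Fin.suc i} {Fin.suc j} e = cong Fin.suc (injective-p e)

  module _ {u u′ v v′ : I} (pre : Star R x u) (r₁ : R u u′) (mid : Star R u′ v)
           (r₂ : R v v′) (post : Star R v′ x) where

    size-arcs : size (pre ◅◅ (r₁ ◅ (mid ◅◅ (r₂ ◅ post)))) ≡
                suc (suc (size mid + size (post ◅◅ pre)))
    size-arcs
      rewrite size-◅◅ pre (r₁ ◅ (mid ◅◅ (r₂ ◅ post)))
            | size-◅◅ mid (r₂ ◅ post)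
            | size-◅◅ post pre =
      solve 3 (λ a m b → a :+ (con 1 :+ (m :+ (con 1 :+ b))) := con 2 :+ (m :+ (b :+ a))) refl
        (size pre) (size mid) (size post)
      where open +-*-Solver

    AnyStep-arcs : {P : ∀ {x y} → R x y → Set} →
                   AnyStep P (pre ◅◅ (r₁ ◅ (mid ◅◅ (r₂ ◅ post)))) →
                   AnyStep P (r₁ ◅ mid) ⊎ AnyStep P (r₂ ◅ (post ◅◅ pre))
    AnyStep-arcs s with AnyStep-++⁻ pre s
    ... | inj₁ s-pre = inj₂ (AnyStep-++⁺ʳ (r₂ ◅ post) s-pre)
    ... | inj₂ s-rest with AnyStep-++⁻ (r₁ ◅ mid) s-rest
    ...   | inj₁ s₁ = inj₁ s₁
    ...   | inj₂ s₂ = inj₂ (AnyStep-++⁺ˡ pre s₂)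

fromℕ-or-inject₁ : ∀ {n} (i : Fin (suc n)) → i ≡ fromℕ n ⊎ ∃ λ j → i ≡ inject₁ j
fromℕ-or-inject₁ {zero}  Fin.zero    = inj₁ refl
fromℕ-or-inject₁ {suc n} Fin.zero    = inj₂ (Fin.zero , refl)
fromℕ-or-inject₁ {suc n} (Fin.suc i) with fromℕ-or-inject₁ i
... | inj₁ refl       = inj₁ refl
... | inj₂ (j , refl) = inj₂ (Fin.suc j , refl)

module _ (Π : Params) where

  next-fromℕ : ∀ m → next Π (fromℕ m) ≡ Fin.zero
  next-fromℕ m = toℕ-injective (trans (toℕ-fromℕ< _)
    (trans (cong (λ k → suc k ℕ.% suc m) (toℕ-fromℕ m)) (n%n≡0 (suc m))))

  next-inject₁ : ∀ {m} (j : Fin m) → next Π (inject₁ j) ≡ Fin.suc j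
  next-inject₁ {m} j = toℕ-injective (trans (toℕ-fromℕ< _)
    (trans (cong (λ k → suc k ℕ.% suc m) (toℕ-inject₁ j)) (m<n⇒m%n≡m (s≤s (toℕ<n j)))))

  module _ {I : Set} {R : Rel I 0ℓ} where

    cycle-reach : ∀ {m} (x : Fin (suc m) → I) → (∀ i → Star R (x i) (x (next Π i))) →
                  ∀ i j → Star R (x i) (x j)
    cycle-reach {m} x seg i j = to-zero i ◅◅ from-zero j
      where
      seg-inject₁ : ∀ k → Star R (x (inject₁ k)) (x (Fin.suc k))
      seg-inject₁ k = subst (Star R (x (inject₁ k)) ∘ x) (next-inject₁ k) (seg (inject₁ k))

      to-zero : ∀ i → Star R (x i) (x Fin.zero)
      to-zero = >-weakInduction (λ i → Star R (x i) (x Fin.zero))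
        (subst (Star R (x (fromℕ m)) ∘ x) (next-fromℕ m) (seg (fromℕ m)))
        (λ k p → seg-inject₁ k ◅◅ p)

      from-zero : ∀ j → Star R (x Fin.zero) (x j)
      from-zero = <-weakInduction (λ j → Star R (x Fin.zero) (x j)) ε (λ k p → p ◅◅ seg-inject₁ k)

    target-inject₁ : ∀ {x y z} (r : R x y) (p : Star R y z) (j : Fin (size p)) →
                     target (r ◅ p) (inject₁ j) ≡ source p j
    target-inject₁ r (r′ ◅ p) Fin.zero    = refl
    target-inject₁ r (r′ ◅ p) (Fin.suc j) = target-inject₁ r′ p j

    target-fromℕ : ∀ {x y z} (r : R x y) (p : Star R y z) → target (r ◅ p) (fromℕ (size p)) ≡ z
    target-fromℕ r ε        = refl
    target-fromℕ r (r′ ◅ p) = target-fromℕ r′ p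

    target≡source-next : ∀ {x y} (r : R x y) (p : Star R y x) (i : Fin (suc (size p))) →
                         target (r ◅ p) i ≡ source (r ◅ p) (next Π i)
    target≡source-next r p i with fromℕ-or-inject₁ i
    ... | inj₁ refl = trans (target-fromℕ r p) (cong (source (r ◅ p)) (sym (next-fromℕ (size p))))
    ... | inj₂ (j , refl) =
      trans (target-inject₁ r p j) (cong (source (r ◅ p)) (sym (next-inject₁ j)))

module _ {n : ℕ} {Q : Pred (Fin n) 0ℓ} (Q? : Decidable Q) where

  Consecutive : Rel (Fin n) 0ℓ
  Consecutive i j = Q i × Q j × i Fin.< j × (∀ k → i Fin.< k → k Fin.< j → ¬ Q k)

  private
    scan : ∀ g {i j} p → g + p ≡ toℕ j → Q i → Q j → toℕ i < p →
           (∀ k → toℕ i < toℕ k → toℕ k < p → ¬ Q k) → Star Consecutive i j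
    scan zero    p refl qi qj i<p none = (qi , qj , i<p , none) ◅ ε
    scan (suc g) {i} {j} p e qi qj i<p none = continue (fromℕ< p<n) (toℕ-fromℕ< p<n)
      where
      p<n : p < n
      p<n = <-trans (subst (p <_) e (s≤s (m≤n+m p g))) (toℕ<n j)

      continue : (k : Fin n) → toℕ k ≡ p → Star Consecutive i j
      continue k k≡p with Q? k
      ... | yes qk = (qi , qk , subst (toℕ i <_) (sym k≡p) i<p , none-before-k)
                     ◅ scan g (suc p) (trans (+-suc g p) e) qk qj (subst (_< suc p) (sym k≡p) (n<1+n p))
                            none-after-k
        where
        none-before-k : ∀ l → toℕ i < toℕ l → toℕ l < toℕ k → ¬ Q l
        none-before-k l i<l l<k = none l i<l (subst (toℕ l <_) k≡p l<k)
        none-after-k : ∀ l → toℕ k < toℕ l → toℕ l < suc p → ¬ Q l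
        none-after-k l k<l l≤p _ =
          <-irrefl refl (<-≤-trans (subst (_< toℕ l) k≡p k<l) (s≤s⁻¹ l≤p))
      ... | no ¬qk = scan g (suc p) (trans (+-suc g p) e) qi qj (<-trans i<p (n<1+n p)) none-upto-p
        where
        none-upto-p : ∀ l → toℕ i < toℕ l → toℕ l < suc p → ¬ Q l
        none-upto-p l i<l l≤p with m≤n⇒m<n∨m≡n (s≤s⁻¹ l≤p)
        ... | inj₁ l<p = none l i<l l<p
        ... | inj₂ l≡p = subst (¬_ ∘ Q) (toℕ-injective (trans k≡p (sym l≡p))) ¬qk

  consecutive-chain : ∀ {i j} → Q i → Q j → i Fin.≤ j → Star Consecutive i j
  consecutive-chain {i} {j} qi qj i≤j with m≤n⇒m<n∨m≡n i≤j
  ... | inj₂ i≡j = subst (Star Consecutive i) (toℕ-injective i≡j) ε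
  ... | inj₁ i<j =
    scan (toℕ j ∸ suc (toℕ i)) (suc (toℕ i)) (trans (+-comm _ (suc (toℕ i))) (m+[n∸m]≡n i<j))
         qi qj (n<1+n (toℕ i)) (λ l i<l l≤i _ → <-irrefl refl (<-≤-trans i<l (s≤s⁻¹ l≤i)))

module Shortcut {I K : Set} (rank : I → K) (pos : I → ℕ) (Edge StrictEdge : Rel I 0ℓ) where

  private variable
    x y z u v : I

  _⊑_ : Rel I 0ℓ
  x ⊑ y = rank x ≡ rank y × pos x ≤ pos y

  _⊏_ : Rel I 0ℓ
  x ⊏ y = rank x ≡ rank y × pos x < pos y

  ⊑-refl : x ⊑ x
  ⊑-refl = refl , ≤-refl

  ⊑-trans : x ⊑ y → y ⊑ z → x ⊑ z
  ⊑-trans (r₁ , p₁) (r₂ , p₂) = trans r₁ r₂ , ≤-trans p₁ p₂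

  ⊑-⊏-trans : x ⊑ y → y ⊏ z → x ⊏ z
  ⊑-⊏-trans (r₁ , p₁) (r₂ , p₂) = trans r₁ r₂ , ≤-<-trans p₁ p₂

  ⊏-⊑-trans : x ⊏ y → y ⊑ z → x ⊏ z
  ⊏-⊑-trans (r₁ , p₁) (r₂ , p₂) = trans r₁ r₂ , <-≤-trans p₁ p₂

  ⊏⇒⊑ : x ⊏ y → x ⊑ y
  ⊏⇒⊑ (r , p) = r , <⇒≤ p

  record Hop (x y : I) : Set where
    constructor hop
    field
      {via}   : I
      advance : x ⊑ via
      edge    : Edge via y

  Strict : Hop x y → Set
  Strict {x} {y} h = pos x < pos (Hop.via h) ⊎ StrictEdge (Hop.via h) y

  record StrictCycle : Set where
    constructor strictCycle
    field
      {base} : I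
      hops   : Star Hop base base
      strict : AnyStep Strict hops
  open StrictCycle

  rejoin : rank u ≡ rank v → (h : Hop v y) → pos u ≤ pos (Hop.via h) → Hop u y
  rejoin u≈v (hop (r , _) e) le = hop (trans u≈v r , le) e

  -- Rejoining arc₂ from u via dj, or arc₁ from v via di, each gives a shorter cycle; comparing
  -- positions shows that one of the two is a chain of hops and keeps a strict hop.
  shortcut : rank u ≡ rank v → ∀ {u′ v′}
             (hu : Hop u u′) (arc₁ : Star Hop u′ v) (hv : Hop v v′) (arc₂ : Star Hop v′ u) →
             AnyStep Strict (hv ◅ arc₂) →
             Σ StrictCycle λ c → size (hops c) ≤ suc (size arc₁ + size arc₂)
  shortcut {u} {v} u≈v hu@(hop {di} (_ , u≤di) _) arc₁ hv@(hop {dj} (_ , v≤dj) _) arc₂ s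
    with pos u ≤? pos dj
  ... | no u≰dj =
    strictCycle (rejoin (sym u≈v) hu (<⇒≤ v<di) ◅ arc₁) (here (inj₁ v<di)) , s≤s (m≤m+n _ _)
    where
    v<di : pos v < pos di
    v<di = <-≤-trans (≤-<-trans v≤dj (≰⇒> u≰dj)) u≤di
  ... | yes u≤dj with s
  ...   | there s₂ =
    strictCycle (rejoin u≈v hv u≤dj ◅ arc₂) (there s₂) , s≤s (m≤n+m _ _)
  ...   | here (inj₂ sharp) =
    strictCycle (rejoin u≈v hv u≤dj ◅ arc₂) (here (inj₂ sharp)) , s≤s (m≤n+m _ _)
  ...   | here (inj₁ v<dj) with pos u <? pos dj
  ...     | yes u<dj =
    strictCycle (rejoin u≈v hv u≤dj ◅ arc₂) (here (inj₁ u<dj)) , s≤s (m≤n+m _ _)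
  ...     | no u≮dj =
    strictCycle (rejoin (sym u≈v) hu (<⇒≤ v<di) ◅ arc₁) (here (inj₁ v<di)) , s≤s (m≤m+n _ _)
    where
    v<di : pos v < pos di
    v<di = <-≤-trans v<dj (≤-trans (≮⇒≥ u≮dj) u≤di)

  shorten : (c : StrictCycle) → Repetition rank (hops c) →
            Σ StrictCycle λ c′ → size (hops c′) < size (hops c)
  shorten (strictCycle _ s) (repetition pre hu mid hv post u≈v refl) =
    Product.map₂ (λ {c} bound → subst (size (hops c) <_) (sym (size-arcs pre hu mid hv post)) (s≤s bound))
      (shortcut-either (AnyStep-arcs pre hu mid hv post s))
    where
    shortcut-either : AnyStep Strict (hu ◅ mid) ⊎ AnyStep Strict (hv ◅ (post ◅◅ pre)) →
                      Σ StrictCycle λ c → size (hops c) ≤ suc (size mid + size (post ◅◅ pre))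
    shortcut-either (inj₂ s₂) = shortcut u≈v hu mid hv (post ◅◅ pre) s₂
    shortcut-either (inj₁ s₁) =
      Product.map₂ (λ {c} → subst (λ n → size (hops c) ≤ suc n) (+-comm (size (post ◅◅ pre)) (size mid)))
        (shortcut (sym u≈v) hv (post ◅◅ pre) hu mid s₁)

  RankDistinct : StrictCycle → Set
  RankDistinct c = Injective _≡_ _≡_ (rank ∘ source (hops c))

  rank-distinct : DecidableEquality K → StrictCycle → Σ StrictCycle RankDistinct
  rank-distinct _≟_ c = go c (<-wellFounded (size (hops c)))
    where
    go : (c : StrictCycle) → Acc _<_ (size (hops c)) → Σ StrictCycle RankDistinct
    go c (acc smaller) with injective-or-repetition rank _≟_ (hops c)
    ... | inj₁ distinct = c , distinct
    ... | inj₂ rep with shorten c rep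
    ...   | c′ , c′<c = go c′ (smaller c′<c)

  module _ {L : Rel I 0ℓ} (L⇒⊏ : ∀ {x y} → L x y → x ⊏ y) where

    private
      Walk : Rel I 0ℓ
      Walk = Star (λ x y → L x y ⊎ Edge x y)

    hops-from : x ⊑ y → Walk y z → ∃ λ t → Star Hop x t × t ⊑ z
    hops-from x⊑y ε            = _ , ε , x⊑y
    hops-from x⊑y (inj₁ l ◅ w) = hops-from (⊑-trans x⊑y (⊏⇒⊑ (L⇒⊏ l))) w
    hops-from x⊑y (inj₂ e ◅ w) with hops-from ⊑-refl w
    ... | t , hs , t⊑z = t , hop x⊑y e ◅ hs , t⊑z

    L*⇒⊑ : Star L x y → x ⊑ y
    L*⇒⊑ ε       = ⊑-refl
    L*⇒⊑ (l ◅ p) = ⊑-trans (⊏⇒⊑ (L⇒⊏ l)) (L*⇒⊑ p)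

    first-edge : Walk x y → Star L x y ⊎ ∃₂ λ u v → Star L x u × Edge u v × Walk v y
    first-edge ε            = inj₁ ε
    first-edge (inj₂ e ◅ w) = inj₂ (_ , _ , ε , e , w)
    first-edge (inj₁ l ◅ w) with first-edge w
    ... | inj₁ ls                    = inj₁ (l ◅ ls)
    ... | inj₂ (u , v , ls , e , w′) = inj₂ (u , v , l ◅ ls , e , w′)

    strictCycle-from : L x y ⊎ (Edge x y × StrictEdge x y) → Walk y x → StrictCycle
    strictCycle-from (inj₂ (e , sharp)) w with hops-from ⊑-refl w
    ... | t , hs , t⊑x =
      strictCycle (hs ◅◅ (hop t⊑x e ◅ ε)) (AnyStep-++⁺ʳ hs (here (inj₂ sharp)))
    strictCycle-from (inj₁ l) w with first-edge w
    ... | inj₁ ls = contradiction (proj₂ (⊏-⊑-trans (L⇒⊏ l) (L*⇒⊑ ls))) (<-irrefl refl)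
    ... | inj₂ (u , v , ls , e , w′) with hops-from ⊑-refl w′
    ...   | t , hs , t⊑x =
      strictCycle (hs ◅◅ (hop (⊏⇒⊑ t⊏u) e ◅ ε)) (AnyStep-++⁺ʳ hs (here (inj₁ (proj₂ t⊏u))))
      where
      t⊏u : t ⊏ u
      t⊏u = ⊑-⊏-trans t⊑x (⊏-⊑-trans (L⇒⊏ l) (L*⇒⊑ ls))

module _ {A : Set} where

  at : List A → ℕ → Maybe A
  at []       _       = nothing
  at (x ∷ xs) zero    = just x
  at (x ∷ xs) (suc n) = at xs n

  private variable
    x : A
    xs ys : List A
    n k : ℕ

  at-lookup : (xs : List A) (i : Fin (length xs)) → at xs (toℕ i) ≡ just (lookup xs i)
  at-lookup (x ∷ xs) Fin.zero    = refl
  at-lookup (x ∷ xs) (Fin.suc i) = at-lookup xs i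

  at-index : (xs : List A) → at xs n ≡ just x → ∃ λ i → toℕ i ≡ n × lookup xs i ≡ x
  at-index {n = zero}  (x ∷ xs) refl = Fin.zero , refl , refl
  at-index {n = suc n} (x ∷ xs) e with at-index xs e
  ... | i , refl , l = Fin.suc i , refl , l

  at-++ˡ : (xs : List A) → at xs n ≡ just x → at (xs ++ ys) n ≡ just x
  at-++ˡ {n = zero}  (x ∷ xs) e = e
  at-++ˡ {n = suc n} (x ∷ xs) e = at-++ˡ xs e

  at-++⁻ : (xs : List A) → at (xs ++ ys) n ≡ just x →
           at xs n ≡ just x ⊎ ∃ λ k → n ≡ length xs + k × at ys k ≡ just x
  at-++⁻ {n = n}     []       e = inj₂ (n , refl , e)
  at-++⁻ {n = zero}  (x ∷ xs) e = inj₁ e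
  at-++⁻ {n = suc n} (x ∷ xs) e with at-++⁻ xs e
  ... | inj₁ e′              = inj₁ e′
  ... | inj₂ (k , refl , e′) = inj₂ (k , refl , e′)

  at-∷ʳ : (xs : List A) → at (xs ++ [ x ]) (length xs) ≡ just x
  at-∷ʳ []       = refl
  at-∷ʳ (x ∷ xs) = at-∷ʳ xs

  at-tabulate : ∀ {m} (f : Fin m → A) → at (tabulate f) k ≡ just x →
                ∃ λ i → toℕ i ≡ k × f i ≡ x
  at-tabulate {k = zero}  {m = suc m} f refl = Fin.zero , refl , refl
  at-tabulate {k = suc k} {m = suc m} f e with at-tabulate (f ∘ Fin.suc) e
  ... | i , refl , fi = Fin.suc i , refl , fi

module Tagging (Π : Params) {N : ℕ} where

  private
    Ev : Set
    Ev = Event Π N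

  module _ (τ : List Ev) where
    open HB Π τ using (NonPop)

    record Issue (t : ℕ) (r : Fin N) : Set where
      constructor issued
      field
        event   : Ev
        at-t    : at τ t ≡ just event
        rank≡   : rank event ≡ r
        tag≡    : tag event ≡ just (inj₁ t)
        nonPop  : NonPop event

    -- A pop carries the tag of the read/write that issued its queue entry; the events of one
    -- barrier step occupy consecutive positions in rank order.
    data Tagged (n : ℕ) (e : Ev) : Maybe (ℕ ⊎ ℕ) → Set where
      plain     : NonPop e → Tagged n e nothing
      issue     : NonPop e → Tagged n e (just (inj₁ n))
      handle    : ∀ {t} → ¬ NonPop e → Issue t (rank e) → Tagged n e (just (inj₁ t))
      inBarrier : ∀ {p} → NonPop e → n ≡ p + toℕ (rank e) → Tagged n e (just (inj₂ p))

    WellTagged : Set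
    WellTagged = ∀ n e → at τ n ≡ just e → Tagged n e (tag e)

  private variable
    τ es : List Ev
    n t : ℕ
    e : Ev
    tg : Maybe (ℕ ⊎ ℕ)

  Issue-++ : ∀ {r} → Issue τ t r → Issue (τ ++ es) t r
  Issue-++ {τ} (issued e at-t rank≡ tag≡ np) = issued e (at-++ˡ τ at-t) rank≡ tag≡ np

  Tagged-++ : Tagged τ n e tg → Tagged (τ ++ es) n e tg
  Tagged-++ (plain np)         = plain np
  Tagged-++ (issue np)         = issue np
  Tagged-++ (handle ¬np i)     = handle ¬np (Issue-++ i)
  Tagged-++ (inBarrier np n≡)  = inBarrier np n≡

  WellTagged-++ : WellTagged τ →
                  (∀ k e → at es k ≡ just e → Tagged (τ ++ es) (length τ + k) e (tag e)) →
                  WellTagged (τ ++ es)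
  WellTagged-++ {τ} old new n e at≡ with at-++⁻ τ at≡
  ... | inj₁ at-τ               = Tagged-++ (old n e at-τ)
  ... | inj₂ (k , refl , at-es) = new k e at-es

  WellTagged-∷ʳ : WellTagged τ → Tagged (τ ++ [ e ]) (length τ) e (tag e) → WellTagged (τ ++ [ e ])
  WellTagged-∷ʳ {τ} {e} old new = WellTagged-++ old λ where
    zero _ refl → subst (λ n → Tagged (τ ++ [ e ]) n e (tag e)) (sym (+-identityʳ (length τ))) new

module Reachable (Π : Params) (P : Program Π) (N : ℕ) where
  open Sem Π P N
  open Tagging Π {N}

  private
    Ev : Set
    Ev = Event Π N

  pOrigin : PEntry → ℕ
  pOrigin (_ , _ , _ , _ , t) = t

  vOrigin : VEntry → ℕ
  vOrigin (_ , _ , _ , t) = t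

  Issued : {B : Set} → (B → ℕ) → List Ev → (Rank → QId Π → List B) → Set
  Issued origin τ Q = ∀ r q → All (λ b → Issue τ (origin b) r) (Q r q)

  record QueuesIssued (τ : List Ev) (pq : Rank → QId Π → List PEntry)
                      (vq : Rank → QId Π → List VEntry) : Set where
    constructor queuesIssued
    field
      pIssued : Issued pOrigin τ pq
      vIssued : Issued vOrigin τ vq

  private variable
    B : Set
    τ es : List Ev
    s : State

  Issued-++ : {origin : B → ℕ} {Q : Rank → QId Π → List B} →
              Issued origin τ Q → Issued origin (τ ++ es) Q
  Issued-++ inv r q = All.map Issue-++ (inv r q)

  QueuesIssued-++ : ∀ {pq vq} → QueuesIssued τ pq vq → QueuesIssued (τ ++ es) pq vq
  QueuesIssued-++ (queuesIssued p v) = queuesIssued (Issued-++ p) (Issued-++ v)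

  Issued-updQ : {origin : B → ℕ} {Q : Rank → QId Π → List B} {r : Rank} {q : QId Π} {bs : List B} →
                Issued origin τ Q → All (λ b → Issue τ (origin b) r) bs →
                Issued origin τ (updQ Q r q bs)
  Issued-updQ {r = r} {q} old new r′ q′ with r′ ≟F r | q′ ≟F q
  ... | yes refl | yes refl = new
  ... | yes refl | no _     = old r′ q′
  ... | no _     | _        = old r′ q′

  dequeue : {origin : B → ℕ} {Q : Rank → QId Π → List B} {r : Rank} {q : QId Π} {b : B} {bs : List B} →
            Issued origin τ Q → Q r q ≡ b ∷ bs →
            Issue τ (origin b) r × All (λ b → Issue τ (origin b) r) bs
  dequeue inv queue≡ with subst (All _) queue≡ (inv _ _)
  ... | head ∷ tail = head , tail

  enqueue : ∀ {e pq vq r q} {entry : PEntry} →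
            Issue (τ ++ [ e ]) (pOrigin entry) r → QueuesIssued τ pq vq →
            QueuesIssued (τ ++ [ e ]) (updQ pq r q (pq r q ++ [ entry ])) vq
  enqueue new (queuesIssued qp qv) =
    queuesIssued (Issued-updQ (Issued-++ qp) (++⁺ (Issued-++ qp _ _) (new ∷ []))) (Issued-++ qv)

  step-preserves : ∀ {s′} → WellTagged τ → QueuesIssued τ (PQ s) (VQ s) →
                   Step (length τ) s es s′ →
                   WellTagged (τ ++ es) × QueuesIssued (τ ++ es) (PQ s′) (VQ s′)
  step-preserves wt qs (st-load _ _)   = WellTagged-∷ʳ wt (plain ((λ ()) , (λ ()))) , QueuesIssued-++ qs
  step-preserves wt qs (st-store _ _)  = WellTagged-∷ʳ wt (plain ((λ ()) , (λ ()))) , QueuesIssued-++ qs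
  step-preserves wt qs (st-assign _)   = WellTagged-∷ʳ wt (plain ((λ ()) , (λ ()))) , QueuesIssued-++ qs
  step-preserves wt qs (st-assume _ _) = WellTagged-∷ʳ wt (plain ((λ ()) , (λ ()))) , QueuesIssued-++ qs
  step-preserves {τ} wt qs (st-write _ _ _ _ _) =
    WellTagged-∷ʳ wt (issue ((λ ()) , (λ ()))) , enqueue (issued _ (at-∷ʳ τ) refl refl ((λ ()) , (λ ()))) qs
  step-preserves {τ} wt qs (st-read _ _ _ _ _) =
    WellTagged-∷ʳ wt (issue ((λ ()) , (λ ()))) , enqueue (issued _ (at-∷ʳ τ) refl refl ((λ ()) , (λ ()))) qs
  step-preserves wt (queuesIssued qp qv) (st-popa {r = r} {q = q} queue≡) with dequeue qp queue≡
  ... | head , tail =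
    WellTagged-∷ʳ wt (handle (λ np → proj₁ np refl) (Issue-++ head)) ,
    QueuesIssued-++ (queuesIssued (Issued-updQ qp tail) (Issued-updQ qv (++⁺ (qv r q) (head ∷ []))))
  step-preserves wt (queuesIssued qp qv) (st-popb queue≡) with dequeue qv queue≡
  ... | head , tail =
    WellTagged-∷ʳ wt (handle (λ np → proj₂ np refl) (Issue-++ head)) ,
    QueuesIssued-++ (queuesIssued qp (Issued-updQ qv tail))
  step-preserves {τ} wt qs (st-barrier _ _) = WellTagged-++ wt barrier-tagged , QueuesIssued-++ qs
    where
    barrier-event : Rank → Ev
    barrier-event r = ⟨ k-barrier , r , nothing , just (inj₂ (length τ)) ⟩

    barrier-tagged : ∀ k e → at (map barrier-event (allFin N)) k ≡ just e →
                     Tagged (τ ++ map barrier-event (allFin N)) (length τ + k) e (tag e)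
    barrier-tagged k e at≡
      with at-tabulate barrier-event (subst (λ es → at es k ≡ just e) (map-tabulate id barrier-event) at≡)
    ... | r , refl , refl = inBarrier ((λ ()) , (λ ())) refl

  reachable⇒wellTagged : Reach τ s → WellTagged τ
  reachable⇒wellTagged = proj₁ ∘ invariant
    where
    invariant : Reach τ s → WellTagged τ × QueuesIssued τ (PQ s) (VQ s)
    invariant r-init              = (λ _ _ ()) , queuesIssued (λ _ _ → []) (λ _ _ → [])
    invariant (r-step reach step) = uncurry step-preserves (invariant reach) step

module Trace (Π : Params) {N : ℕ} (τ : List (Event Π N)) where
  open HB Π τ

  AnyEdge-split : {R S : Rel Idx 0ℓ} {x y : Idx} {p : Star R x y} → AnyEdge Π S p →
                  ∃₂ λ u v → Star R x u × R u v × S u v × Star R v y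
  AnyEdge-split (here {r = r} {rs = rs} s) = _ , _ , ε , r , s , rs
  AnyEdge-split (there {r = r} any) with AnyEdge-split any
  ... | u , v , pre , r′ , s , post = u , v , r ◅ pre , r′ , s , post

  ¬Eqv : Rel Idx 0ℓ
  ¬Eqv i j = ¬ Eqv i j

  Eqv-sym : ∀ {i j} → Eqv i j → Eqv j i
  Eqv-sym (i≢j , x , tag-i , tag-j) = i≢j ∘ sym , x , tag-j , tag-i

  Eqv*-¬AnyEdge : {x y : Idx} {p : Star Eqv x y} → ¬ AnyEdge Π ¬Eqv p
  Eqv*-¬AnyEdge (here {r = e} ¬e) = ¬e e
  Eqv*-¬AnyEdge (there any)       = Eqv*-¬AnyEdge any

  module _ (W : CycleWitness Π τ) where
    open CycleWitness W

    private
      eqv-steps : ∀ {x y} → Star Eqv x y → Star HBrel x y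
      eqv-steps = Star.map (inj₂ ∘ inj₂)

      po-steps : ∀ {x y} → Star Po x y → Star HBrel x y
      po-steps = Star.map inj₁

      segment : ∀ i → Star HBrel (a i) (a (next Π i))
      segment i = eqv-steps (ab i) ◅◅ po-steps (bc i) ◅◅ eqv-steps (cd i) ◅◅ (inj₂ (da i) ◅ ε)

      around : ∀ i → Star HBrel (a (next Π i)) (a i)
      around i = cycle-reach Π a segment (next Π i) i

    witness⇒violating : Violating
    witness⇒violating with notInEqv
    ... | i , inj₁ in-ab                = contradiction in-ab Eqv*-¬AnyEdge
    ... | i , inj₂ (inj₂ (inj₁ in-cd))  = contradiction in-cd Eqv*-¬AnyEdge
    ... | i , inj₂ (inj₂ (inj₂ ¬e))     =
      d i , a (next Π i) , inj₂ (da i) , ¬e ,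
      around i ◅◅ eqv-steps (ab i) ◅◅ po-steps (bc i) ◅◅ eqv-steps (cd i)
    ... | i , inj₂ (inj₁ in-bc) with AnyEdge-split in-bc
    ...   | u , v , pre , po , ¬e , post =
      u , v , inj₁ po , ¬e ,
      po-steps post ◅◅ eqv-steps (cd i) ◅◅ (inj₂ (da i) ◅ around i ◅◅ eqv-steps (ab i) ◅◅ po-steps pre)

module HappensBefore (Π : Params) {N : ℕ} (τ : List (Event Π N))
                     (wellTagged : Tagging.WellTagged Π τ) where
  open HB Π τ
  open Tagging Π {N}
  open Trace Π τ using (¬Eqv; Eqv-sym)

  private variable
    i j : Idx

  nonPop? : (e : Event Π N) → Dec (NonPop e)
  nonPop? e with kind e
  ... | k-popa    = no (λ np → proj₁ np refl)
  ... | k-popb    = no (λ np → proj₂ np refl)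
  ... | k-load    = yes ((λ ()) , (λ ()))
  ... | k-store   = yes ((λ ()) , (λ ()))
  ... | k-assign  = yes ((λ ()) , (λ ()))
  ... | k-assume  = yes ((λ ()) , (λ ()))
  ... | k-read    = yes ((λ ()) , (λ ()))
  ... | k-write   = yes ((λ ()) , (λ ()))
  ... | k-barrier = yes ((λ ()) , (λ ()))

  tagged : ∀ i → Tagged τ (toℕ i) (ev i) (tag (ev i))
  tagged i = wellTagged (toℕ i) (ev i) (at-lookup τ i)

  tagPosition : ℕ ⊎ ℕ → Fin N → ℕ
  tagPosition (inj₁ t) _ = t
  tagPosition (inj₂ p) r = p + toℕ r

  nonPop-position : ∀ {n e x} → NonPop e → Tagged τ n e (just x) → n ≡ tagPosition x (rank e)
  nonPop-position np (issue _)        = refl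
  nonPop-position np (handle ¬np _)   = contradiction np ¬np
  nonPop-position np (inBarrier _ n≡) = n≡

  tagged-as : ∀ {x} → tag (ev i) ≡ just x → Tagged τ (toℕ i) (ev i) (just x)
  tagged-as {i} tag-i = subst (Tagged τ (toℕ i) (ev i)) tag-i (tagged i)

  nonPop-¬Eqv : NonPop (ev i) → NonPop (ev j) → rank (ev i) ≡ rank (ev j) → ¬ Eqv i j
  nonPop-¬Eqv {i} {j} npi npj i≈j (i≢j , x , tag-i , tag-j) = i≢j (toℕ-injective (begin
    toℕ i                        ≡⟨ nonPop-position npi (tagged-as tag-i) ⟩
    tagPosition x (rank (ev i))  ≡⟨ cong (tagPosition x) i≈j ⟩
    tagPosition x (rank (ev j))  ≡⟨ nonPop-position npj (tagged-as tag-j) ⟨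
    toℕ j                        ∎))
    where open ≡-Reasoning

  record Origin (i : Idx) : Set where
    constructor origin
    field
      index     : Idx
      nonPop    : NonPop (ev index)
      rank≡     : rank (ev index) ≡ rank (ev i)
      linked    : Star Eqv i index
      nonPop⇒id : NonPop (ev i) → index ≡ i
  open Origin

  originOf : ∀ i {tg} → tag (ev i) ≡ tg → Tagged τ (toℕ i) (ev i) tg → Origin i
  originOf i _ (plain np)       = origin i np refl ε (λ _ → refl)
  originOf i _ (issue np)       = origin i np refl ε (λ _ → refl)
  originOf i _ (inBarrier np _) = origin i np refl ε (λ _ → refl)
  originOf i tag-i (handle ¬np (issued e at-t rank≡ tag≡ np)) with at-index τ at-t
  ... | j , _ , refl = origin j np rank≡ (link ◅ ε) (λ npi → contradiction npi ¬np)
    where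
    link : Eqv i j
    link = (λ { refl → ¬np np }) , _ , tag-i , tag≡

  originAt : ∀ i → Origin i
  originAt i = originOf i refl (tagged i)

  pos : Idx → ℕ
  pos i = toℕ (index (originAt i))

  open Shortcut (rank ∘ ev) pos Cyc ¬Eqv

  po-⊏ : Po i j → i ⊏ j
  po-⊏ {i} {j} (i≈j , npi , npj , i<j , _)
    rewrite nonPop⇒id (originAt i) npi | nonPop⇒id (originAt j) npj = i≈j , i<j

  po-chain : NonPop (ev i) → NonPop (ev j) → rank (ev i) ≡ rank (ev j) → i Fin.≤ j → Star Po i j
  po-chain {i} npi npj i≈j i≤j =
    Star.map consecutive⇒po (consecutive-chain Q? (refl , npi) (sym i≈j , npj) i≤j)
    where
    Q? : Decidable (λ k → rank (ev k) ≡ rank (ev i) × NonPop (ev k))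
    Q? k = (rank (ev k) ≟F rank (ev i)) ×-dec nonPop? (ev k)

    consecutive⇒po : ∀ {x y} → Consecutive Q? x y → Po x y
    consecutive⇒po ((x≈ , npx) , (y≈ , npy) , x<y , none) =
      trans x≈ (sym y≈) , npx , npy , x<y , λ k x<k k<y k≈x npk → none k x<k k<y (trans k≈x x≈ , npk)

  po-chain-¬Eqv : ∀ {x y} (p : Star Po x y) → x ≢ y → AnyEdge Π ¬Eqv p
  po-chain-¬Eqv ε                           x≢x = contradiction refl x≢x
  po-chain-¬Eqv ((x≈y , npx , npy , _) ◅ _) _   = here (nonPop-¬Eqv npx npy x≈y)

  witness : Σ StrictCycle RankDistinct → CycleWitness Π τ
  witness (strictCycle ε () , _)
  witness (strictCycle {x} (h ◅ hs) strict , distinct) = record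
    { m = size hs ; a = a ; b = b ; c = c ; d = d
    ; ab = ab ; bc = bc ; cd = cd
    ; da = λ i → subst (Cyc (d i)) (target≡source-next Π h hs i) (Hop.edge (step cycle i))
    ; notInEqv = not-in-Eqv (AnyStep-step strict)
    ; rankSep = λ i j s t → mk⇔ (λ e → distinct (trans (sym (block-rank i s)) (trans e (block-rank j t))))
                                 (λ { refl → trans (block-rank i s) (sym (block-rank i t)) })
    }
    where
    cycle : Star Hop x x
    cycle = h ◅ hs

    Block : Set
    Block = Fin (suc (size hs))

    a d b c : Block → Idx
    a = source cycle
    d i = Hop.via (step cycle i)
    b i = index (originAt (a i))
    c i = index (originAt (d i))

    ab : ∀ i → Star Eqv (a i) (b i)
    ab i = linked (originAt (a i))

    cd : ∀ i → Star Eqv (c i) (d i)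
    cd i = Star.reverse Eqv-sym (linked (originAt (d i)))

    a≈d : ∀ i → rank (ev (a i)) ≡ rank (ev (d i))
    a≈d i = proj₁ (Hop.advance (step cycle i))

    bc : ∀ i → Star Po (b i) (c i)
    bc i = po-chain (nonPop (originAt (a i))) (nonPop (originAt (d i)))
                    (trans (rank≡ (originAt (a i))) (trans (a≈d i) (sym (rank≡ (originAt (d i))))))
                    (proj₂ (Hop.advance (step cycle i)))

    block-rank : ∀ i s → rank (ev (quad Π a b c d i s)) ≡ rank (ev (a i))
    block-rank i Fin.zero                               = refl
    block-rank i (Fin.suc Fin.zero)                     = rank≡ (originAt (a i))
    block-rank i (Fin.suc (Fin.suc Fin.zero))           = trans (rank≡ (originAt (d i))) (sym (a≈d i))
    block-rank i (Fin.suc (Fin.suc (Fin.suc Fin.zero))) = sym (a≈d i)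

    not-in-Eqv : (∃ λ i → Strict (step cycle i)) →
                 ∃ λ i → AnyEdge Π ¬Eqv (ab i) ⊎ AnyEdge Π ¬Eqv (bc i) ⊎ AnyEdge Π ¬Eqv (cd i) ⊎
                         ¬ Eqv (d i) (a (next Π i))
    not-in-Eqv (i , inj₁ a<d) = i , inj₂ (inj₁ (po-chain-¬Eqv (bc i) (λ b≡c → <-irrefl (cong toℕ b≡c) a<d)))
    not-in-Eqv (i , inj₂ ¬e)  =
      i , inj₂ (inj₂ (inj₂ (subst (¬Eqv (d i)) (target≡source-next Π h hs i) ¬e)))

  violating⇒witness : Violating → CycleWitness Π τ
  violating⇒witness (_ , _ , hb , ¬eqv , w) =
    witness (rank-distinct _≟F_ (strictCycle-from po-⊏ (Sum.map₂ (_, ¬eqv) hb) w))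

lemma7 : (Π : Params) (P : Program Π) (N : ℕ) (τ : List (Event Π N)) →
         Sem.InC Π P N τ →
         (HB.Violating Π τ ⇔ CycleWitness Π τ)
lemma7 Π P N τ (_ , reach , _) = mk⇔ violating⇒witness (Trace.witness⇒violating Π τ)
  where open HappensBefore Π τ (Reachable.reachable⇒wellTagged Π P N reach)
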